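{- For any non-constant $f:\{0,1\}^n\to\{0,1\}$, there is a coordinate $i\in[n]$ with $\textsc{BalInf}_i(f)\ge\dfrac{1}{\mathrm{Depth}(f)}\ge\dfrac1n$.
   Context: $\mathrm{Depth}(f)$ is the minimum depth of a decision tree computing $f$. The balanced distribution $\mathcal{D}_{\mathrm{bal}}^{(f)}$ is sampled by drawing a uniform bit $b$ and then uniform $x\in f^{ -1}(b)$; $\textsc{BalInf}_i(f)=\Pr_{x\sim\mathcal{D}_{\mathrm{bal}}^{(f)}}[f(x)\ne f(x^{\oplus i})]$, with $x^{\oplus i}$ being $x$ with bit $i$ flipped. -}

module Defs where

open import Data.Bool using (Bool; true; false; if_then_else_; not; _xor_)
open import Data.Nat as ℕ using (ℕ; zero; suc; _⊔_)
open import Data.Fin using (Fin)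
open import Data.Vec using (Vec; []; _∷_; lookup; updateAt)
open import Data.List using (List; []; _∷_; _++_; map; foldr; filter; length)
open import Data.Integer using (+_)
open import Data.Rational using (ℚ; _/_; _+_; _*_; 0ℚ)
open import Data.Product using (Σ; _×_; ∃; ∃-syntax)
open import Data.Bool.Properties using (_≟_)
open import Relation.Binary.PropositionalEquality using (_≡_)

BoolFun : ℕ → Set
BoolFun n = Vec Bool n → Bool

allInputs : (n : ℕ) → List (Vec Bool n)
allInputs zero = [] ∷ []
allInputs (suc n) = map (false ∷_) (allInputs n) ++ map (true ∷_) (allInputs n)

flipBit : ∀ {n} → Fin n → Vec Bool n → Vec Bool n
flipBit i x = updateAt x i not

data DTree (n : ℕ) : Set where
  leaf : Bool → DTree n
  node : Fin n → DTree n → DTree n → DTree n   -- query x_i; left if 0, right if 1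

evalDT : ∀ {n} → DTree n → Vec Bool n → Bool
evalDT (leaf b) x = b
evalDT (node i t₀ t₁) x = if lookup x i then evalDT t₁ x else evalDT t₀ x

depthDT : ∀ {n} → DTree n → ℕ
depthDT (leaf _) = 0
depthDT (node _ t₀ t₁) = suc (depthDT t₀ ⊔ depthDT t₁)

Computes : ∀ {n} → DTree n → BoolFun n → Set
Computes T f = ∀ x → evalDT T x ≡ f x

IsDepth : ∀ {n} → BoolFun n → ℕ → Set
IsDepth f d = Σ (DTree _) (λ T → Computes T f × depthDT T ≡ d)
            × (∀ T → Computes T f → d ℕ.≤ depthDT T)

NonConstant : ∀ {n} → BoolFun n → Set
NonConstant f = ∃[ x ] ∃[ y ] (¬≡ (f x) (f y))
  where
  open import Relation.Nullary using (¬_)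
  ¬≡ : Bool → Bool → Set
  ¬≡ a b = ¬ (a ≡ b)

-- 1/k as a rational (only used for k ≥ 1; 0 for k = 0)
inv : ℕ → ℚ
inv zero = 0ℚ
inv (suc k) = + 1 / suc k

sumℚ : List ℚ → ℚ
sumℚ = foldr _+_ 0ℚ

preimageSize : ∀ {n} → BoolFun n → Bool → ℕ
preimageSize {n} f b = length (filter (λ x → f x ≟ b) (allInputs n))

-- probability mass of x under the balanced distribution D_bal^(f):
-- (1/2) · 1/|f⁻¹(f x)|   (the denominator is ≥ 1 since x ∈ f⁻¹(f x))
balWeight : ∀ {n} → BoolFun n → Vec Bool n → ℚ
balWeight f x = (+ 1 / 2) * inv (preimageSize f (f x))

indicator : Bool → ℚ
indicator true = + 1 / 1
indicator false = 0ℚ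

BalInf : ∀ {n} → Fin n → BoolFun n → ℚ
BalInf {n} i f =
  sumℚ (map (λ x → balWeight f x * indicator (f x xor f (flipBit i x)))
            (allInputs n))

-- The O'Donnell–Saks–Schramm–Servedio inequality: if a decision tree T computes h, then for every g
--   4 Cov(h, g) ≤ Σᵢ δᵢ(T) Infᵢ(g),   where δᵢ(T) = Pr[T queries xᵢ].
-- It holds by induction on T: with xⱼ the root variable and h_β, g_γ the restrictions of h, g to the
-- halves xⱼ = β, xⱼ = γ of the cube, 4 Cov(h, g) ≤ Infⱼ(g) + Σ_{β,γ} Cov(h_β, g_γ); the subtrees bound
-- the four covariances, and Infᵢ(g₀) + Infᵢ(g₁) ≤ 2 Infᵢ(g).
-- Take h = g = f, T of depth d, a = |f⁻¹(1)|, b = |f⁻¹(0)| and i of maximal influence: then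
-- 4ab/(a+b)² ≤ d Infᵢ(f). If f changes along s edges in direction i, then Infᵢ(f) = 2s/(a+b) and
-- BalInfᵢ(f) = s/(2a) + s/(2b), so BalInfᵢ(f) ≥ 1/d. Finally d ≤ n, as the complete tree has depth n.

module Submission where

open import Algebra.Bundles using (CommutativeMonoid)
open import Data.Bool using (Bool; true; false; not; _xor_; _∧_; if_then_else_)
open import Data.Bool.Properties
  using (xor-same; xor-comm; not-involutive; if-float) renaming (_≟_ to _≟ᵇ_)
open import Data.Empty using (⊥-elim)
open import Data.Fin using (Fin; zero; suc; _≟_)
open import Data.Integer as ℤ using (ℤ; +_; 0ℤ; 1ℤ; _+_; _-_; _*_; _≤_; +≤+; -≤+)
import Data.Integer.Properties as ℤP
open import Data.Integer.Tactic.RingSolver using (solve-∀)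
open import Data.List using (List; []; _∷_; _++_; length; map; filter; filterᵇ; allFin)
open import Data.List.Extrema ℤP.≤-totalOrder using (argmax; f[xs]≤f[argmax])
open import Data.List.Membership.Propositional using (_∈_; lose)
open import Data.List.Membership.Propositional.Properties using (∈-map⁺; ∈-++⁺ˡ; ∈-++⁺ʳ; ∈-allFin)
open import Data.List.Properties using (filter-++; length-++; filter-some; map-cong)
import Data.List.Relation.Unary.All as All
open import Data.List.Relation.Unary.Any using (here)
open import Data.Maybe using (Maybe; just; nothing; fromMaybe)
open import Data.Nat as ℕ using (ℕ; zero; suc; z≤n; s≤s; _⊔_)
import Data.Nat.Properties as ℕP
open import Data.Product using (_×_; _,_; proj₁; proj₂; ∃-syntax)
open import Data.Rational as ℚ using (ℚ; _/_; ½; 0ℚ; 1ℚ; toℚᵘ)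
import Data.Rational.Properties as ℚP
open import Data.Rational.Unnormalised as ℚᵘ using (ℚᵘ; mkℚᵘ; *≡*; *≤*)
import Data.Rational.Unnormalised.Properties as ℚᵘP
open import Data.Vec using (Vec; []; _∷_; lookup; _[_]≔_; zipWith; replicate)
open import Data.Vec.Properties
  using (updateAt-commutes; updateAt-updateAt; updateAt-id-local; lookup∘update; lookup-zipWith)
open import Function using (_∘_)
open import Level using (0ℓ)
open import Relation.Binary.PropositionalEquality
open import Relation.Nullary using (yes; no; does)
open import Relation.Nullary.Decidable using (T?)
open import Relation.Unary using (Pred; Decidable)

open import Defs

open import Algebra.Properties.CommutativeSemigroup ℤP.+-commutativeSemigroup using (interchange)
open import Algebra.Properties.CommutativeSemigroup
  (CommutativeMonoid.commutativeSemigroup ℚP.+-0-commutativeMonoid)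
  using () renaming (interchange to ℚ-interchange)

∑ : ∀ {n} → (Vec Bool n → ℤ) → ℤ
∑ {zero}  F = F []
∑ {suc n} F = ∑ (F ∘ (false ∷_)) + ∑ (F ∘ (true ∷_))

cubeSize : ℕ → ℤ
cubeSize n = ∑ {n} (λ _ → 1ℤ)

∑-cong : ∀ {n} {F G : Vec Bool n → ℤ} → (∀ x → F x ≡ G x) → ∑ F ≡ ∑ G
∑-cong {zero}  F≗G = F≗G []
∑-cong {suc n} F≗G = cong₂ _+_ (∑-cong (F≗G ∘ (false ∷_))) (∑-cong (F≗G ∘ (true ∷_)))

∑-mono-≤ : ∀ {n} {F G : Vec Bool n → ℤ} → (∀ x → F x ≤ G x) → ∑ F ≤ ∑ G
∑-mono-≤ {zero}  F≤G = F≤G []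
∑-mono-≤ {suc n} F≤G = ℤP.+-mono-≤ (∑-mono-≤ (F≤G ∘ (false ∷_))) (∑-mono-≤ (F≤G ∘ (true ∷_)))

∑-nonNeg : ∀ {n} {F : Vec Bool n → ℤ} → (∀ x → 0ℤ ≤ F x) → 0ℤ ≤ ∑ F
∑-nonNeg {zero}  0≤F = 0≤F []
∑-nonNeg {suc n} 0≤F = ℤP.+-mono-≤ (∑-nonNeg (0≤F ∘ (false ∷_))) (∑-nonNeg (0≤F ∘ (true ∷_)))

cubeSize-nonNeg : ∀ n → 0ℤ ≤ cubeSize n
cubeSize-nonNeg n = ∑-nonNeg {n} (λ _ → +≤+ z≤n)

∑-distrib-+ : ∀ {n} (F G : Vec Bool n → ℤ) → ∑ (λ x → F x + G x) ≡ ∑ F + ∑ G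
∑-distrib-+ {zero}  F G = refl
∑-distrib-+ {suc n} F G =
  trans (cong₂ _+_ (∑-distrib-+ (F ∘ (false ∷_)) (G ∘ (false ∷_)))
                   (∑-distrib-+ (F ∘ (true ∷_)) (G ∘ (true ∷_))))
        (interchange (∑ (F ∘ (false ∷_))) (∑ (G ∘ (false ∷_))) (∑ (F ∘ (true ∷_))) (∑ (G ∘ (true ∷_))))

∑-distrib-- : ∀ {n} (F G : Vec Bool n → ℤ) → ∑ (λ x → F x - G x) ≡ ∑ F - ∑ G
∑-distrib-- {zero}  F G = refl
∑-distrib-- {suc n} F G =
  trans (cong₂ _+_ (∑-distrib-- (F ∘ (false ∷_)) (G ∘ (false ∷_)))
                   (∑-distrib-- (F ∘ (true ∷_)) (G ∘ (true ∷_))))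
        (regroup (∑ (F ∘ (false ∷_))) (∑ (G ∘ (false ∷_))) (∑ (F ∘ (true ∷_))) (∑ (G ∘ (true ∷_))))
  where
  regroup : ∀ a b c d → (a - b) + (c - d) ≡ (a + c) - (b + d)
  regroup = solve-∀

∑-*ˡ : ∀ {n} c (F : Vec Bool n → ℤ) → ∑ (λ x → c * F x) ≡ c * ∑ F
∑-*ˡ {zero}  c F = refl
∑-*ˡ {suc n} c F =
  trans (cong₂ _+_ (∑-*ˡ c (F ∘ (false ∷_))) (∑-*ˡ c (F ∘ (true ∷_))))
        (sym (ℤP.*-distribˡ-+ c (∑ (F ∘ (false ∷_))) (∑ (F ∘ (true ∷_)))))

∑-const : ∀ n c → ∑ {n} (λ _ → c) ≡ cubeSize n * c
∑-const n c = begin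
  ∑ {n} (λ _ → c)       ≡⟨ ∑-cong {n} (λ _ → sym (ℤP.*-identityʳ c)) ⟩
  ∑ {n} (λ _ → c * 1ℤ)  ≡⟨ ∑-*ˡ {n} c (λ _ → 1ℤ) ⟩
  c * cubeSize n        ≡⟨ ℤP.*-comm c (cubeSize n) ⟩
  cubeSize n * c        ∎
  where open ≡-Reasoning

∑-flip : ∀ {n} (i : Fin n) (F : Vec Bool n → ℤ) → ∑ (F ∘ flipBit i) ≡ ∑ F
∑-flip {suc n} zero    F = ℤP.+-comm (∑ (F ∘ (true ∷_))) (∑ (F ∘ (false ∷_)))
∑-flip {suc n} (suc i) F = cong₂ _+_ (∑-flip i (F ∘ (false ∷_))) (∑-flip i (F ∘ (true ∷_)))

∑-[]≔ : ∀ {n} (j : Fin n) (F : Vec Bool n → ℤ) →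
        ∑ (λ x → F (x [ j ]≔ false)) + ∑ (λ x → F (x [ j ]≔ true)) ≡ + 2 * ∑ F
∑-[]≔ {suc n} zero    F = double (∑ (F ∘ (false ∷_))) (∑ (F ∘ (true ∷_)))
  where
  double : ∀ a b → (a + a) + (b + b) ≡ + 2 * (a + b)
  double = solve-∀
∑-[]≔ {suc n} (suc j) F = begin
  (∑ (F₀ ∘ [j]≔0) + ∑ (F₁ ∘ [j]≔0)) + (∑ (F₀ ∘ [j]≔1) + ∑ (F₁ ∘ [j]≔1))
    ≡⟨ interchange (∑ (F₀ ∘ [j]≔0)) (∑ (F₁ ∘ [j]≔0)) (∑ (F₀ ∘ [j]≔1)) (∑ (F₁ ∘ [j]≔1)) ⟩
  (∑ (F₀ ∘ [j]≔0) + ∑ (F₀ ∘ [j]≔1)) + (∑ (F₁ ∘ [j]≔0) + ∑ (F₁ ∘ [j]≔1))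
    ≡⟨ cong₂ _+_ (∑-[]≔ j F₀) (∑-[]≔ j F₁) ⟩
  + 2 * ∑ F₀ + + 2 * ∑ F₁
    ≡⟨ ℤP.*-distribˡ-+ (+ 2) (∑ F₀) (∑ F₁) ⟨
  + 2 * (∑ F₀ + ∑ F₁)  ∎
  where
  open ≡-Reasoning
  F₀ F₁ : Vec Bool n → ℤ
  F₀ = F ∘ (false ∷_)
  F₁ = F ∘ (true ∷_)
  [j]≔0 [j]≔1 : Vec Bool n → Vec Bool n
  [j]≔0 x = x [ j ]≔ false
  [j]≔1 x = x [ j ]≔ true

-- Influence and covariance

⟦_⟧ : Bool → ℤ
⟦ true  ⟧ = 1ℤ
⟦ false ⟧ = 0ℤ

⟦⟧-nonNeg : ∀ b → 0ℤ ≤ ⟦ b ⟧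
⟦⟧-nonNeg true  = +≤+ z≤n
⟦⟧-nonNeg false = +≤+ z≤n

⟦⟧-idem : ∀ b → ⟦ b ⟧ * ⟦ b ⟧ ≡ ⟦ b ⟧
⟦⟧-idem true  = refl
⟦⟧-idem false = refl

⟦⟧-+-not : ∀ b → ⟦ b ⟧ + ⟦ not b ⟧ ≡ 1ℤ
⟦⟧-+-not true  = refl
⟦⟧-+-not false = refl

_⟨_≔_⟩ : ∀ {n} {A : Set} → (Vec Bool n → A) → Fin n → Bool → Vec Bool n → A
(g ⟨ j ≔ b ⟩) x = g (x [ j ]≔ b)

-- N Infᵢ(g) and N² Cov(h, g) for N = 2ⁿ: counting instead of averaging keeps everything in ℤ.

influence : ∀ {n} → (Vec Bool n → Bool) → Fin n → ℤ
influence g i = ∑ λ x → ⟦ g x xor g (flipBit i x) ⟧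

covariance : ∀ {n} → (h g : Vec Bool n → Bool) → ℤ
covariance {n} h g = cubeSize n * ∑ (λ x → ⟦ h x ⟧ * ⟦ g x ⟧) - ∑ (⟦_⟧ ∘ h) * ∑ (⟦_⟧ ∘ g)

influence-nonNeg : ∀ {n} (g : Vec Bool n → Bool) i → 0ℤ ≤ influence g i
influence-nonNeg {n} g i = ∑-nonNeg {n} (λ x → ⟦⟧-nonNeg _)

flipBit-[]≔ : ∀ {n} (j : Fin n) b x → flipBit j (x [ j ]≔ b) ≡ x [ j ]≔ not b
flipBit-[]≔ j b x = updateAt-updateAt j x

[]≔-flipBit : ∀ {n} (j : Fin n) b x → flipBit j x [ j ]≔ b ≡ x [ j ]≔ b
[]≔-flipBit j b x = updateAt-updateAt j x

flipBit-involutive : ∀ {n} (i : Fin n) x → flipBit i (flipBit i x) ≡ x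
flipBit-involutive i x = trans (updateAt-updateAt i x) (updateAt-id-local i x (not-involutive (lookup x i)))

influence-as-restrictions : ∀ {n} (g : Vec Bool n → Bool) j →
  influence g j ≡ ∑ λ x → ⟦ (g ⟨ j ≔ false ⟩) x xor (g ⟨ j ≔ true ⟩) x ⟧
influence-as-restrictions {n} g j = ℤP.*-cancelˡ-≡ (+ 2) _ _ (begin
  + 2 * influence g j                                    ≡⟨ ∑-[]≔ j (λ x → ⟦ g x xor g (flipBit j x) ⟧) ⟨
  ∑ (λ x → ⟦ g₀ x xor g (flipBit j (x [ j ]≔ false)) ⟧) +
  ∑ (λ x → ⟦ g₁ x xor g (flipBit j (x [ j ]≔ true)) ⟧)   ≡⟨ cong₂ _+_ (∑-cong across₀) (∑-cong across₁) ⟩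
  ∑ edge + ∑ edge                                        ≡⟨ double (∑ edge) ⟩
  + 2 * ∑ edge                                           ∎)
  where
  open ≡-Reasoning
  double : ∀ a → a + a ≡ + 2 * a
  double = solve-∀
  g₀ g₁ : Vec Bool n → Bool
  g₀ = g ⟨ j ≔ false ⟩
  g₁ = g ⟨ j ≔ true ⟩
  edge : Vec Bool n → ℤ
  edge x = ⟦ g₀ x xor g₁ x ⟧
  across₀ : ∀ x → ⟦ g₀ x xor g (flipBit j (x [ j ]≔ false)) ⟧ ≡ edge x
  across₀ x = cong (λ y → ⟦ g₀ x xor g y ⟧) (flipBit-[]≔ j false x)
  across₁ : ∀ x → ⟦ g₁ x xor g (flipBit j (x [ j ]≔ true)) ⟧ ≡ edge x
  across₁ x = cong ⟦_⟧ (trans (cong (λ y → g₁ x xor g y) (flipBit-[]≔ j true x)) (xor-comm (g₁ x) (g₀ x)))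

influence-restriction-≤ : ∀ {n} (g : Vec Bool n → Bool) j i →
  influence (g ⟨ j ≔ false ⟩) i + influence (g ⟨ j ≔ true ⟩) i ≤ + 2 * influence g i
influence-restriction-≤ {n} g j i with i ≟ j
... | yes refl = ℤP.≤-trans (ℤP.≤-reflexive (cong₂ _+_ (frozen false) (frozen true)))
                            (ℤP.*-monoˡ-≤-nonNeg (+ 2) (influence-nonNeg g j))
  where
  frozen : ∀ b → influence (g ⟨ j ≔ b ⟩) j ≡ 0ℤ
  frozen b = begin
    influence (g ⟨ j ≔ b ⟩) j
      ≡⟨ ∑-cong (λ x → cong (λ y → ⟦ g (x [ j ]≔ b) xor g y ⟧) ([]≔-flipBit j b x)) ⟩
    ∑ (λ x → ⟦ g (x [ j ]≔ b) xor g (x [ j ]≔ b) ⟧)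
      ≡⟨ ∑-cong (λ x → cong ⟦_⟧ (xor-same (g (x [ j ]≔ b)))) ⟩
    ∑ {n} (λ _ → 0ℤ)
      ≡⟨ ∑-const n 0ℤ ⟩
    cubeSize n * 0ℤ
      ≡⟨ ℤP.*-zeroʳ (cubeSize n) ⟩
    0ℤ ∎
    where open ≡-Reasoning
... | no i≢j = ℤP.≤-reflexive (trans (cong₂ _+_ (commute false) (commute true))
                                     (∑-[]≔ j (λ x → ⟦ g x xor g (flipBit i x) ⟧)))
  where
  commute : ∀ b → influence (g ⟨ j ≔ b ⟩) i ≡ ∑ (λ x → ⟦ g (x [ j ]≔ b) xor g (flipBit i (x [ j ]≔ b)) ⟧)
  commute b = ∑-cong (λ x → cong (λ y → ⟦ g (x [ j ]≔ b) xor g y ⟧) (sym (updateAt-commutes i j i≢j x)))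

covariance-cong : ∀ {n} {h h′ : Vec Bool n → Bool} (g : Vec Bool n → Bool) →
                  (∀ x → h x ≡ h′ x) → covariance h g ≡ covariance h′ g
covariance-cong {n} g h≗h′ = cong₂ (λ S A → cubeSize n * S - A * ∑ (⟦_⟧ ∘ g))
  (∑-cong (λ x → cong (λ b → ⟦ b ⟧ * ⟦ g x ⟧) (h≗h′ x)))
  (∑-cong (λ x → cong ⟦_⟧ (h≗h′ x)))

covariance-const : ∀ {n} b (g : Vec Bool n → Bool) → covariance (λ _ → b) g ≡ 0ℤ
covariance-const {n} b g = begin
  cubeSize n * ∑ (λ x → ⟦ b ⟧ * ⟦ g x ⟧) - ∑ {n} (λ _ → ⟦ b ⟧) * ∑ (⟦_⟧ ∘ g)
    ≡⟨ cong₂ (λ S A → cubeSize n * S - A * ∑ (⟦_⟧ ∘ g)) (∑-*ˡ ⟦ b ⟧ (⟦_⟧ ∘ g)) (∑-const n ⟦ b ⟧) ⟩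
  cubeSize n * (⟦ b ⟧ * ∑ (⟦_⟧ ∘ g)) - cubeSize n * ⟦ b ⟧ * ∑ (⟦_⟧ ∘ g)
    ≡⟨ cancel (cubeSize n) ⟦ b ⟧ (∑ (⟦_⟧ ∘ g)) ⟩
  0ℤ ∎
  where
  open ≡-Reasoning
  cancel : ∀ N c S → N * (c * S) - N * c * S ≡ 0ℤ
  cancel = solve-∀

cubeSize-split : ∀ {n} (f : Vec Bool n → Bool) → cubeSize n ≡ ∑ (⟦_⟧ ∘ f) + ∑ (⟦_⟧ ∘ not ∘ f)
cubeSize-split {n} f = trans (∑-cong (λ x → sym (⟦⟧-+-not (f x)))) (∑-distrib-+ {n} _ _)

covariance-self : ∀ {n} (f : Vec Bool n → Bool) → covariance f f ≡ ∑ (⟦_⟧ ∘ f) * ∑ (⟦_⟧ ∘ not ∘ f)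
covariance-self {n} f = begin
  cubeSize n * ∑ (λ x → ⟦ f x ⟧ * ⟦ f x ⟧) - A * A
    ≡⟨ cong₂ (λ N S → N * S - A * A) (cubeSize-split f) (∑-cong (⟦⟧-idem ∘ f)) ⟩
  (A + B) * A - A * A
    ≡⟨ simplify A B ⟩
  A * B ∎
  where
  open ≡-Reasoning
  A B : ℤ
  A = ∑ (⟦_⟧ ∘ f)
  B = ∑ (⟦_⟧ ∘ not ∘ f)
  simplify : ∀ A B → (A + B) * A - A * A ≡ A * B
  simplify = solve-∀

difference-product-≤ : ∀ a₀ a₁ c₀ c₁ → (⟦ a₀ ⟧ - ⟦ a₁ ⟧) * (⟦ c₀ ⟧ - ⟦ c₁ ⟧) ≤ ⟦ c₀ xor c₁ ⟧
difference-product-≤ false false false false = +≤+ z≤n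
difference-product-≤ false false false true  = +≤+ z≤n
difference-product-≤ false false true  false = +≤+ z≤n
difference-product-≤ false false true  true  = +≤+ z≤n
difference-product-≤ false true  false false = +≤+ z≤n
difference-product-≤ false true  false true  = +≤+ (s≤s z≤n)
difference-product-≤ false true  true  false = -≤+
difference-product-≤ false true  true  true  = +≤+ z≤n
difference-product-≤ true  false false false = +≤+ z≤n
difference-product-≤ true  false false true  = -≤+
difference-product-≤ true  false true  false = +≤+ (s≤s z≤n)
difference-product-≤ true  false true  true  = +≤+ z≤n
difference-product-≤ true  true  false false = +≤+ z≤n
difference-product-≤ true  true  false true  = +≤+ z≤n
difference-product-≤ true  true  true  false = +≤+ z≤n
difference-product-≤ true  true  true  true  = +≤+ z≤n

-- 4 Cov(h, g) = E[(h₀ − h₁)(g₀ − g₁)] + Σ_{β,γ} Cov(h_β, g_γ), and (h₀ − h₁)(g₀ − g₁) ≤ [g₀ ≠ g₁].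
covariance-split : ∀ {n} (h g : Vec Bool n → Bool) j →
  + 4 * covariance h g ≤
  cubeSize n * influence g j +
  ((covariance (h ⟨ j ≔ false ⟩) (g ⟨ j ≔ false ⟩) + covariance (h ⟨ j ≔ false ⟩) (g ⟨ j ≔ true ⟩)) +
   (covariance (h ⟨ j ≔ true ⟩) (g ⟨ j ≔ false ⟩) + covariance (h ⟨ j ≔ true ⟩) (g ⟨ j ≔ true ⟩)))
covariance-split {n} h g j = begin
  + 4 * (N * S - A * B)
    ≡⟨ rescale N S A B ⟩
  N * (+ 2 * S) * + 2 - (+ 2 * A) * (+ 2 * B)
    ≡⟨ cong₂ (λ u v → N * u * + 2 - v) (∑-[]≔ j (λ x → ⟦ h x ⟧ * ⟦ g x ⟧))
                                       (cong₂ _*_ (∑-[]≔ j (⟦_⟧ ∘ h)) (∑-[]≔ j (⟦_⟧ ∘ g))) ⟨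
  N * (P₀₀ + P₁₁) * + 2 - (H₀ + H₁) * (G₀ + G₁)
    ≡⟨ expand N P₀₀ P₀₁ P₁₀ P₁₁ H₀ H₁ G₀ G₁ ⟩
  N * ((P₀₀ + P₁₁) - (P₀₁ + P₁₀)) + covariances
    ≡⟨ cong (λ t → N * t + covariances) between ⟨
  N * ∑ (λ x → (⟦ h₀ x ⟧ - ⟦ h₁ x ⟧) * (⟦ g₀ x ⟧ - ⟦ g₁ x ⟧)) + covariances
    ≤⟨ ℤP.+-monoˡ-≤ covariances (ℤP.*-monoˡ-≤-nonNeg N {{ℤ.nonNegative (cubeSize-nonNeg n)}}
         (∑-mono-≤ (λ x → difference-product-≤ (h₀ x) (h₁ x) (g₀ x) (g₁ x)))) ⟩
  N * ∑ (λ x → ⟦ g₀ x xor g₁ x ⟧) + covariances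
    ≡⟨ cong (λ t → N * t + covariances) (influence-as-restrictions g j) ⟨
  N * influence g j + covariances ∎
  where
  open ℤP.≤-Reasoning
  N S A B : ℤ
  N = cubeSize n
  S = ∑ (λ x → ⟦ h x ⟧ * ⟦ g x ⟧)
  A = ∑ (⟦_⟧ ∘ h)
  B = ∑ (⟦_⟧ ∘ g)
  h₀ h₁ g₀ g₁ : Vec Bool n → Bool
  h₀ = h ⟨ j ≔ false ⟩
  h₁ = h ⟨ j ≔ true ⟩
  g₀ = g ⟨ j ≔ false ⟩
  g₁ = g ⟨ j ≔ true ⟩
  P₀₀ P₀₁ P₁₀ P₁₁ H₀ H₁ G₀ G₁ covariances : ℤ
  P₀₀ = ∑ (λ x → ⟦ h₀ x ⟧ * ⟦ g₀ x ⟧)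
  P₀₁ = ∑ (λ x → ⟦ h₀ x ⟧ * ⟦ g₁ x ⟧)
  P₁₀ = ∑ (λ x → ⟦ h₁ x ⟧ * ⟦ g₀ x ⟧)
  P₁₁ = ∑ (λ x → ⟦ h₁ x ⟧ * ⟦ g₁ x ⟧)
  H₀ = ∑ (⟦_⟧ ∘ h₀)
  H₁ = ∑ (⟦_⟧ ∘ h₁)
  G₀ = ∑ (⟦_⟧ ∘ g₀)
  G₁ = ∑ (⟦_⟧ ∘ g₁)
  covariances = (covariance h₀ g₀ + covariance h₀ g₁) + (covariance h₁ g₀ + covariance h₁ g₁)
  rescale : ∀ N S A B → + 4 * (N * S - A * B) ≡ N * (+ 2 * S) * + 2 - (+ 2 * A) * (+ 2 * B)
  rescale = solve-∀
  expand : ∀ N P₀₀ P₀₁ P₁₀ P₁₁ H₀ H₁ G₀ G₁ →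
    N * (P₀₀ + P₁₁) * + 2 - (H₀ + H₁) * (G₀ + G₁) ≡
    N * ((P₀₀ + P₁₁) - (P₀₁ + P₁₀)) +
    ((N * P₀₀ - H₀ * G₀ + (N * P₀₁ - H₀ * G₁)) + (N * P₁₀ - H₁ * G₀ + (N * P₁₁ - H₁ * G₁)))
  expand = solve-∀
  product-expand : ∀ a₀ a₁ c₀ c₁ → (a₀ - a₁) * (c₀ - c₁) ≡ (a₀ * c₀ + a₁ * c₁) - (a₀ * c₁ + a₁ * c₀)
  product-expand = solve-∀
  between : ∑ (λ x → (⟦ h₀ x ⟧ - ⟦ h₁ x ⟧) * (⟦ g₀ x ⟧ - ⟦ g₁ x ⟧)) ≡ (P₀₀ + P₁₁) - (P₀₁ + P₁₀)
  between = trans (∑-cong (λ x → product-expand ⟦ h₀ x ⟧ ⟦ h₁ x ⟧ ⟦ g₀ x ⟧ ⟦ g₁ x ⟧))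
                  (trans (∑-distrib-- {n} _ _) (cong₂ _-_ (∑-distrib-+ {n} _ _) (∑-distrib-+ {n} _ _)))

-- The subtrees of a node are again trees over all n variables and may query the root variable
-- again, so the induction runs over trees evaluated on a subcube: ρ fixes the coordinates where
-- it is just b and leaves the others free.
Restriction : ℕ → Set
Restriction n = Vec (Maybe Bool) n

restrict : ∀ {n} → Restriction n → Vec Bool n → Vec Bool n
restrict ρ x = zipWith fromMaybe x ρ

unrestricted : ∀ n → Restriction n
unrestricted n = replicate n nothing

restrict-unrestricted : ∀ {n} (x : Vec Bool n) → restrict (unrestricted n) x ≡ x
restrict-unrestricted []      = refl
restrict-unrestricted (a ∷ x) = cong (a ∷_) (restrict-unrestricted x)

lookup-restrict-fixed : ∀ {n} (ρ : Restriction n) j {c} x → lookup ρ j ≡ just c → lookup (restrict ρ x) j ≡ c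
lookup-restrict-fixed ρ j x ρⱼ≡c = trans (lookup-zipWith fromMaybe j x ρ) (cong (fromMaybe (lookup x j)) ρⱼ≡c)

restrict-[]≔ : ∀ {n} (ρ : Restriction n) j b x → lookup ρ j ≡ nothing →
               restrict ρ (x [ j ]≔ b) ≡ restrict (ρ [ j ]≔ just b) x
restrict-[]≔ (_ ∷ ρ) zero    b (_ ∷ x) refl = refl
restrict-[]≔ (m ∷ ρ) (suc j) b (a ∷ x) ρⱼ≡∅ = cong (fromMaybe a m ∷_) (restrict-[]≔ ρ j b x ρⱼ≡∅)

queries : ∀ {n} → DTree n → Vec Bool n → List (Fin n)
queries (leaf _)       x = []
queries (node j t₀ t₁) x = j ∷ (if lookup x j then queries t₁ x else queries t₀ x)

evalDT-node : ∀ {n} j (t₀ t₁ : DTree n) x →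
              evalDT (node j t₀ t₁) x ≡ evalDT (if lookup x j then t₁ else t₀) x
evalDT-node j t₀ t₁ x = sym (if-float (λ t → evalDT t x) (lookup x j))

queries-node : ∀ {n} j (t₀ t₁ : DTree n) x →
               queries (node j t₀ t₁) x ≡ j ∷ queries (if lookup x j then t₁ else t₀) x
queries-node j t₀ t₁ x = cong (j ∷_) (sym (if-float (λ t → queries t x) (lookup x j)))

length-queries-≤ : ∀ {n} (T : DTree n) x → length (queries T x) ℕ.≤ depthDT T
length-queries-≤ (leaf _)       x = z≤n
length-queries-≤ (node j t₀ t₁) x with lookup x j
... | false = s≤s (ℕP.≤-trans (length-queries-≤ t₀ x) (ℕP.m≤m⊔n _ _))
... | true  = s≤s (ℕP.≤-trans (length-queries-≤ t₁ x) (ℕP.m≤n⊔m _ _))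

influenceSum : ∀ {n} → (Vec Bool n → Bool) → List (Fin n) → ℤ
influenceSum g []       = 0ℤ
influenceSum g (i ∷ is) = influence g i + influenceSum g is

influenceSum-nonNeg : ∀ {n} (g : Vec Bool n → Bool) is → 0ℤ ≤ influenceSum g is
influenceSum-nonNeg g []       = +≤+ z≤n
influenceSum-nonNeg g (i ∷ is) = ℤP.+-mono-≤ (influence-nonNeg g i) (influenceSum-nonNeg g is)

influenceSum-restriction-≤ : ∀ {n} (g : Vec Bool n → Bool) j is →
  influenceSum (g ⟨ j ≔ false ⟩) is + influenceSum (g ⟨ j ≔ true ⟩) is ≤ + 2 * influenceSum g is
influenceSum-restriction-≤ g j []       = +≤+ z≤n
influenceSum-restriction-≤ {n} g j (i ∷ is) = begin
  (influence g₀ i + influenceSum g₀ is) + (influence g₁ i + influenceSum g₁ is)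
    ≡⟨ interchange (influence g₀ i) (influenceSum g₀ is) (influence g₁ i) (influenceSum g₁ is) ⟩
  (influence g₀ i + influence g₁ i) + (influenceSum g₀ is + influenceSum g₁ is)
    ≤⟨ ℤP.+-mono-≤ (influence-restriction-≤ g j i) (influenceSum-restriction-≤ g j is) ⟩
  + 2 * influence g i + + 2 * influenceSum g is
    ≡⟨ ℤP.*-distribˡ-+ (+ 2) (influence g i) (influenceSum g is) ⟨
  + 2 * influenceSum g (i ∷ is) ∎
  where
  open ℤP.≤-Reasoning
  g₀ g₁ : Vec Bool n → Bool
  g₀ = g ⟨ j ≔ false ⟩
  g₁ = g ⟨ j ≔ true ⟩

influenceSum-≤ : ∀ {n} (g : Vec Bool n → Bool) {I} → (∀ j → influence g j ≤ I) →
                 ∀ is → influenceSum g is ≤ + length is * I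
influenceSum-≤ g {I} infl≤I []       = ℤP.≤-reflexive (sym (ℤP.*-zeroˡ I))
influenceSum-≤ g {I} infl≤I (i ∷ is) =
  ℤP.≤-trans (ℤP.+-mono-≤ (infl≤I i) (influenceSum-≤ g infl≤I is))
             (ℤP.≤-reflexive (sym (ℤP.suc-* (+ length is) I)))

-- N² Σᵢ δᵢ Infᵢ(g), where δᵢ is the probability that T queries xᵢ on a random point of the subcube ρ.
revealedInfluence : ∀ {n} → DTree n → Restriction n → (Vec Bool n → Bool) → ℤ
revealedInfluence T ρ g = ∑ λ x → influenceSum g (queries T (restrict ρ x))

revealedInfluence-nonNeg : ∀ {n} (T : DTree n) ρ g → 0ℤ ≤ revealedInfluence T ρ g
revealedInfluence-nonNeg {n} T ρ g = ∑-nonNeg {n} (λ x → influenceSum-nonNeg g (queries T (restrict ρ x)))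

revealedInfluence-restriction-≤ : ∀ {n} (T : DTree n) ρ g j →
  revealedInfluence T ρ (g ⟨ j ≔ false ⟩) + revealedInfluence T ρ (g ⟨ j ≔ true ⟩) ≤
  + 2 * revealedInfluence T ρ g
revealedInfluence-restriction-≤ {n} T ρ g j = begin
  revealedInfluence T ρ (g ⟨ j ≔ false ⟩) + revealedInfluence T ρ (g ⟨ j ≔ true ⟩)
    ≡⟨ ∑-distrib-+ {n} _ _ ⟨
  ∑ (λ x → influenceSum (g ⟨ j ≔ false ⟩) (path x) + influenceSum (g ⟨ j ≔ true ⟩) (path x))
    ≤⟨ ∑-mono-≤ (λ x → influenceSum-restriction-≤ g j (path x)) ⟩
  ∑ (λ x → + 2 * influenceSum g (path x))
    ≡⟨ ∑-*ˡ (+ 2) (λ x → influenceSum g (path x)) ⟩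
  + 2 * revealedInfluence T ρ g ∎
  where
  open ℤP.≤-Reasoning
  path : Vec Bool n → List (Fin n)
  path x = queries T (restrict ρ x)

-- The OSSS inequality

osss-fixed-node : ∀ {n} j (t₀ t₁ : DTree n) ρ g {c} → lookup ρ j ≡ just c →
  + 4 * covariance (evalDT (if c then t₁ else t₀) ∘ restrict ρ) g ≤
  revealedInfluence (if c then t₁ else t₀) ρ g →
  + 4 * covariance (evalDT (node j t₀ t₁) ∘ restrict ρ) g ≤ revealedInfluence (node j t₀ t₁) ρ g
osss-fixed-node {n} j t₀ t₁ ρ g {c} ρⱼ≡c osss-child = begin
  + 4 * covariance (evalDT (node j t₀ t₁) ∘ restrict ρ) g  ≡⟨ cong (+ 4 *_) (covariance-cong g same-output) ⟩
  + 4 * covariance (evalDT child ∘ restrict ρ) g            ≤⟨ osss-child ⟩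
  revealedInfluence child ρ g                               ≤⟨ ∑-mono-≤ longer-path ⟩
  revealedInfluence (node j t₀ t₁) ρ g                      ∎
  where
  open ℤP.≤-Reasoning
  child : DTree n
  child = if c then t₁ else t₀
  fixed-branch : ∀ {A : Set} (F : DTree n → Vec Bool n → A) x →
             F (if lookup (restrict ρ x) j then t₁ else t₀) (restrict ρ x) ≡ F child (restrict ρ x)
  fixed-branch F x = cong (λ b → F (if b then t₁ else t₀) (restrict ρ x)) (lookup-restrict-fixed ρ j x ρⱼ≡c)
  same-output : ∀ x → evalDT (node j t₀ t₁) (restrict ρ x) ≡ evalDT child (restrict ρ x)
  same-output x = trans (evalDT-node j t₀ t₁ _) (fixed-branch evalDT x)
  longer-path : ∀ x → influenceSum g (queries child (restrict ρ x)) ≤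
                      influenceSum g (queries (node j t₀ t₁) (restrict ρ x))
  longer-path x = ℤP.≤-trans (ℤP.i≤j+i _ (influence g j) {{ℤ.nonNegative (influence-nonNeg g j)}})
    (ℤP.≤-reflexive (cong (influenceSum g) (sym (trans (queries-node j t₀ t₁ _)
                                                       (cong (j ∷_) (fixed-branch queries x))))))

module FreeNode {n} (j : Fin n) (t₀ t₁ : DTree n) (ρ : Restriction n) (ρⱼ≡∅ : lookup ρ j ≡ nothing) where

  child : Bool → DTree n
  child b = if b then t₁ else t₀

  fix : Bool → Restriction n
  fix b = ρ [ j ]≔ just b

  at-child : ∀ {A : Set} {F : Vec Bool n → A} (G : DTree n → Vec Bool n → A) →
             (∀ x → F x ≡ G (if lookup x j then t₁ else t₀) x) →
             ∀ b x → F (restrict ρ (x [ j ]≔ b)) ≡ G (child b) (restrict (fix b) x)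
  at-child {F = F} G F≡G b x = begin
    F (restrict ρ (x [ j ]≔ b))                  ≡⟨ cong F (restrict-[]≔ ρ j b x ρⱼ≡∅) ⟩
    F (restrict (fix b) x)                       ≡⟨ F≡G (restrict (fix b) x) ⟩
    G (child (lookup (restrict (fix b) x) j)) _  ≡⟨ cong (λ c → G (child c) (restrict (fix b) x)) fixed ⟩
    G (child b) (restrict (fix b) x)             ∎
    where
    open ≡-Reasoning
    fixed : lookup (restrict (fix b) x) j ≡ b
    fixed = lookup-restrict-fixed (fix b) j x (lookup∘update j ρ (just b))

  childCovariance : (Vec Bool n → Bool) → Bool → Bool → ℤ
  childCovariance g b c = covariance (evalDT (child b) ∘ restrict (fix b)) (g ⟨ j ≔ c ⟩)

  covariance-split-node : ∀ g →
    + 4 * covariance (evalDT (node j t₀ t₁) ∘ restrict ρ) g ≤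
    cubeSize n * influence g j +
    ((childCovariance g false false + childCovariance g false true) +
     (childCovariance g true false + childCovariance g true true))
  covariance-split-node g = subst (λ t → + 4 * covariance h g ≤ cubeSize n * influence g j + t)
    (cong₂ _+_ (cong₂ _+_ (restricted false false) (restricted false true))
               (cong₂ _+_ (restricted true false) (restricted true true)))
    (covariance-split h g j)
    where
    h : Vec Bool n → Bool
    h = evalDT (node j t₀ t₁) ∘ restrict ρ
    restricted : ∀ b c → covariance (h ⟨ j ≔ b ⟩) (g ⟨ j ≔ c ⟩) ≡ childCovariance g b c
    restricted b c = covariance-cong (g ⟨ j ≔ c ⟩) (at-child evalDT (evalDT-node j t₀ t₁) b)

  revealedInfluence-split : ∀ g →
    + 2 * revealedInfluence (node j t₀ t₁) ρ g ≡
    (cubeSize n * influence g j + revealedInfluence t₀ (fix false) g) +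
    (cubeSize n * influence g j + revealedInfluence t₁ (fix true) g)
  revealedInfluence-split g = begin
    + 2 * revealedInfluence (node j t₀ t₁) ρ g
      ≡⟨ ∑-[]≔ j (λ x → influenceSum g (queries (node j t₀ t₁) (restrict ρ x))) ⟨
    ∑ (λ x → influenceSum g (queries (node j t₀ t₁) (restrict ρ (x [ j ]≔ false)))) +
    ∑ (λ x → influenceSum g (queries (node j t₀ t₁) (restrict ρ (x [ j ]≔ true))))
      ≡⟨ cong₂ _+_ (∑-cong (cong (influenceSum g) ∘ path false)) (∑-cong (cong (influenceSum g) ∘ path true)) ⟩
    ∑ (λ x → influence g j + influenceSum g (queries t₀ (restrict (fix false) x))) +
    ∑ (λ x → influence g j + influenceSum g (queries t₁ (restrict (fix true) x)))
      ≡⟨ cong₂ _+_ (∑-distrib-+ {n} _ _) (∑-distrib-+ {n} _ _) ⟩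
    (∑ {n} (λ _ → influence g j) + revealedInfluence t₀ (fix false) g) +
    (∑ {n} (λ _ → influence g j) + revealedInfluence t₁ (fix true) g)
      ≡⟨ cong (λ c → (c + revealedInfluence t₀ (fix false) g) + (c + revealedInfluence t₁ (fix true) g))
              (∑-const n (influence g j)) ⟩
    (cubeSize n * influence g j + revealedInfluence t₀ (fix false) g) +
    (cubeSize n * influence g j + revealedInfluence t₁ (fix true) g) ∎
    where
    open ≡-Reasoning
    path : ∀ b x → queries (node j t₀ t₁) (restrict ρ (x [ j ]≔ b)) ≡ j ∷ queries (child b) (restrict (fix b) x)
    path = at-child (λ t x → j ∷ queries t x) (queries-node j t₀ t₁)

  osss-free-node : ∀ g →
    (∀ b c → + 4 * childCovariance g b c ≤ revealedInfluence (child b) (fix b) (g ⟨ j ≔ c ⟩)) →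
    + 4 * covariance (evalDT (node j t₀ t₁) ∘ restrict ρ) g ≤ revealedInfluence (node j t₀ t₁) ρ g
  osss-free-node g osss-children = ℤP.*-cancelˡ-≤-pos _ _ (+ 4) (begin
    + 4 * (+ 4 * covariance (evalDT (node j t₀ t₁) ∘ restrict ρ) g)
      ≤⟨ ℤP.*-monoˡ-≤-nonNeg (+ 4) (covariance-split-node g) ⟩
    + 4 * (N * I + ((C false false + C false true) + (C true false + C true true)))
      ≡⟨ distribute (N * I) (C false false) (C false true) (C true false) (C true true) ⟩
    + 4 * (N * I) + ((+ 4 * C false false + + 4 * C false true) + (+ 4 * C true false + + 4 * C true true))
      ≤⟨ ℤP.+-monoʳ-≤ (+ 4 * (N * I))
           (ℤP.+-mono-≤ (ℤP.+-mono-≤ (osss-children false false) (osss-children false true))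
                        (ℤP.+-mono-≤ (osss-children true false) (osss-children true true))) ⟩
    + 4 * (N * I) + ((R false false + R false true) + (R true false + R true true))
      ≤⟨ ℤP.+-monoʳ-≤ (+ 4 * (N * I))
           (ℤP.+-mono-≤ (revealedInfluence-restriction-≤ t₀ (fix false) g j)
                        (revealedInfluence-restriction-≤ t₁ (fix true) g j)) ⟩
    + 4 * (N * I) + (+ 2 * W false + + 2 * W true)
      ≡⟨ regroup (N * I) (W false) (W true) ⟩
    + 2 * ((N * I + W false) + (N * I + W true))
      ≡⟨ cong (+ 2 *_) (revealedInfluence-split g) ⟨
    + 2 * (+ 2 * revealedInfluence (node j t₀ t₁) ρ g)
      ≡⟨ ℤP.*-assoc (+ 2) (+ 2) (revealedInfluence (node j t₀ t₁) ρ g) ⟨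
    + 4 * revealedInfluence (node j t₀ t₁) ρ g ∎)
    where
    open ℤP.≤-Reasoning
    N I : ℤ
    N = cubeSize n
    I = influence g j
    C R : Bool → Bool → ℤ
    C = childCovariance g
    R b c = revealedInfluence (child b) (fix b) (g ⟨ j ≔ c ⟩)
    W : Bool → ℤ
    W b = revealedInfluence (child b) (fix b) g
    distribute : ∀ a c₀₀ c₀₁ c₁₀ c₁₁ →
      + 4 * (a + ((c₀₀ + c₀₁) + (c₁₀ + c₁₁))) ≡ + 4 * a + ((+ 4 * c₀₀ + + 4 * c₀₁) + (+ 4 * c₁₀ + + 4 * c₁₁))
    distribute = solve-∀
    regroup : ∀ a w₀ w₁ → + 4 * a + (+ 2 * w₀ + + 2 * w₁) ≡ + 2 * ((a + w₀) + (a + w₁))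
    regroup = solve-∀

osss : ∀ {n} (T : DTree n) ρ g → + 4 * covariance (evalDT T ∘ restrict ρ) g ≤ revealedInfluence T ρ g
osss (leaf b) ρ g = ℤP.≤-trans (ℤP.≤-reflexive (cong (+ 4 *_) (covariance-const b g)))
                               (revealedInfluence-nonNeg (leaf b) ρ g)
osss (node j t₀ t₁) ρ g with lookup ρ j in ρⱼ
... | just false = osss-fixed-node j t₀ t₁ ρ g ρⱼ (osss t₀ ρ g)
... | just true  = osss-fixed-node j t₀ t₁ ρ g ρⱼ (osss t₁ ρ g)
... | nothing    = osss-free-node g osss-children
  where
  open FreeNode j t₀ t₁ ρ ρⱼ
  osss-children : ∀ b c → + 4 * childCovariance g b c ≤ revealedInfluence (child b) (fix b) (g ⟨ j ≔ c ⟩)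
  osss-children false c = osss t₀ (fix false) (g ⟨ j ≔ c ⟩)
  osss-children true  c = osss t₁ (fix true) (g ⟨ j ≔ c ⟩)

osss-depth : ∀ {n} {f : Vec Bool n → Bool} {T : DTree n} i → Computes T f →
             (∀ j → influence f j ≤ influence f i) →
             + 4 * covariance f f ≤ cubeSize n * (+ depthDT T * influence f i)
osss-depth {n} {f} {T} i T-computes-f i-maximal = begin
  + 4 * covariance f f                                       ≡⟨ cong (+ 4 *_) (covariance-cong f computed) ⟨
  + 4 * covariance (evalDT T ∘ restrict (unrestricted n)) f  ≤⟨ osss T (unrestricted n) f ⟩
  revealedInfluence T (unrestricted n) f                     ≤⟨ ∑-mono-≤ path-bound ⟩
  ∑ {n} (λ _ → + depthDT T * influence f i)                  ≡⟨ ∑-const n _ ⟩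
  cubeSize n * (+ depthDT T * influence f i)                 ∎
  where
  open ℤP.≤-Reasoning
  computed : ∀ x → evalDT T (restrict (unrestricted n) x) ≡ f x
  computed x = trans (cong (evalDT T) (restrict-unrestricted x)) (T-computes-f x)
  path-bound : ∀ x → influenceSum f (queries T (restrict (unrestricted n) x)) ≤ + depthDT T * influence f i
  path-bound x = ℤP.≤-trans (influenceSum-≤ f i-maximal (queries T (restrict (unrestricted n) x)))
    (ℤP.*-monoʳ-≤-nonNeg (influence f i) {{ℤ.nonNegative (influence-nonNeg f i)}}
                         (+≤+ (length-queries-≤ T _)))

count : ∀ {n} → (Vec Bool n → Bool) → ℕ
count {n} p = length (filterᵇ p (allInputs n))

length-filter-map : ∀ {A B : Set} {P : Pred B 0ℓ} (P? : Decidable P) (g : A → B) xs →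
                    length (filter P? (map g xs)) ≡ length (filter (P? ∘ g) xs)
length-filter-map P? g []       = refl
length-filter-map P? g (x ∷ xs) with does (P? (g x))
... | true  = cong suc (length-filter-map P? g xs)
... | false = length-filter-map P? g xs

length-filter-allInputs : ∀ {n} {P : Pred (Vec Bool n) 0ℓ} (P? : Decidable P) →
                          + length (filter P? (allInputs n)) ≡ ∑ λ x → ⟦ does (P? x) ⟧
length-filter-allInputs {zero} P? with does (P? [])
... | true  = refl
... | false = refl
length-filter-allInputs {suc n} P? = begin
  + length (filter P? (map (false ∷_) xs ++ map (true ∷_) xs))
    ≡⟨ cong (+_ ∘ length) (filter-++ P? (map (false ∷_) xs) (map (true ∷_) xs)) ⟩
  + length (filter P? (map (false ∷_) xs) ++ filter P? (map (true ∷_) xs))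
    ≡⟨ cong +_ (length-++ (filter P? (map (false ∷_) xs))) ⟩
  + (length (filter P? (map (false ∷_) xs)) ℕ.+ length (filter P? (map (true ∷_) xs)))
    ≡⟨ cong +_ (cong₂ ℕ._+_ (length-filter-map P? (false ∷_) xs) (length-filter-map P? (true ∷_) xs)) ⟩
  + (length (filter (P? ∘ (false ∷_)) xs) ℕ.+ length (filter (P? ∘ (true ∷_)) xs))
    ≡⟨ ℤP.pos-+ (length (filter (P? ∘ (false ∷_)) xs)) (length (filter (P? ∘ (true ∷_)) xs)) ⟩
  + length (filter (P? ∘ (false ∷_)) xs) + + length (filter (P? ∘ (true ∷_)) xs)
    ≡⟨ cong₂ _+_ (length-filter-allInputs (P? ∘ (false ∷_))) (length-filter-allInputs (P? ∘ (true ∷_))) ⟩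
  ∑ (λ x → ⟦ does (P? x) ⟧) ∎
  where
  open ≡-Reasoning
  xs : List (Vec Bool n)
  xs = allInputs n

count-∑ : ∀ {n} (p : Vec Bool n → Bool) → + count p ≡ ∑ (⟦_⟧ ∘ p)
count-∑ p = length-filter-allInputs (T? ∘ p)

preimageSize-true : ∀ {n} (f : Vec Bool n → Bool) → + preimageSize f true ≡ ∑ (⟦_⟧ ∘ f)
preimageSize-true f =
  trans (length-filter-allInputs (λ x → f x ≟ᵇ true)) (∑-cong (λ x → cong ⟦_⟧ (is-true (f x))))
  where
  is-true : ∀ b → does (b ≟ᵇ true) ≡ b
  is-true true  = refl
  is-true false = refl

preimageSize-false : ∀ {n} (f : Vec Bool n → Bool) → + preimageSize f false ≡ ∑ (⟦_⟧ ∘ not ∘ f)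
preimageSize-false f =
  trans (length-filter-allInputs (λ x → f x ≟ᵇ false)) (∑-cong (λ x → cong ⟦_⟧ (is-false (f x))))
  where
  is-false : ∀ b → does (b ≟ᵇ false) ≡ not b
  is-false true  = refl
  is-false false = refl

∈-allInputs : ∀ {n} (x : Vec Bool n) → x ∈ allInputs n
∈-allInputs []          = here refl
∈-allInputs (false ∷ x) = ∈-++⁺ˡ (∈-map⁺ (false ∷_) (∈-allInputs x))
∈-allInputs (true ∷ x)  = ∈-++⁺ʳ _ (∈-map⁺ (true ∷_) (∈-allInputs x))

preimageSize-pos : ∀ {n} (f : Vec Bool n → Bool) x {b} → f x ≡ b → 0 ℕ.< preimageSize f b
preimageSize-pos f x refl = filter-some (λ y → f y ≟ᵇ f x) (lose (∈-allInputs x) refl)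

preimages-nonempty : ∀ {n} {f : Vec Bool n → Bool} → NonConstant f →
                     0 ℕ.< preimageSize f true × 0 ℕ.< preimageSize f false
preimages-nonempty {f = f} (x , y , fx≢fy) with f x in fx≡ | f y in fy≡
... | true  | true  = ⊥-elim (fx≢fy refl)
... | false | false = ⊥-elim (fx≢fy refl)
... | true  | false = preimageSize-pos f x fx≡ , preimageSize-pos f y fy≡
... | false | true  = preimageSize-pos f y fy≡ , preimageSize-pos f x fx≡

-- Normalised rationals do not compute on open terms, so identities and inequalities between them
-- are established in ℚᵘ, where numerators and denominators of sums and products do compute.
toℚᵘ-/ : ∀ k m → toℚᵘ (+ k / suc m) ℚᵘ.≃ mkℚᵘ (+ k) m
toℚᵘ-/ k m = ℚP.toℚᵘ-fromℚᵘ (mkℚᵘ (+ k) m)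

/1-suc : ∀ k → + suc k / 1 ≡ 1ℚ ℚ.+ + k / 1
/1-suc k = ℚP.toℚᵘ-injective (ℚᵘP.≃-sym (begin
  toℚᵘ (1ℚ ℚ.+ + k / 1)          ≈⟨ ℚP.toℚᵘ-homo-+ 1ℚ (+ k / 1) ⟩
  toℚᵘ 1ℚ ℚᵘ.+ toℚᵘ (+ k / 1)    ≈⟨ ℚᵘP.+-cong (toℚᵘ-/ 1 0) (toℚᵘ-/ k 0) ⟩
  mkℚᵘ 1ℤ 0 ℚᵘ.+ mkℚᵘ (+ k) 0    ≈⟨ *≡* (cong (_* + 1) (add-units (+ k))) ⟩
  mkℚᵘ (+ suc k) 0               ≈⟨ toℚᵘ-/ (suc k) 0 ⟨
  toℚᵘ (+ suc k / 1)             ∎))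
  where
  open import Relation.Binary.Reasoning.Setoid ℚᵘP.≃-setoid
  add-units : ∀ a → 1ℤ * 1ℤ + a * 1ℤ ≡ 1ℤ + a
  add-units = solve-∀

sumℚ-map-+ : ∀ {A : Set} (F G : A → ℚ) xs →
             sumℚ (map (λ x → F x ℚ.+ G x) xs) ≡ sumℚ (map F xs) ℚ.+ sumℚ (map G xs)
sumℚ-map-+ F G []       = sym (ℚP.+-identityˡ 0ℚ)
sumℚ-map-+ F G (x ∷ xs) = trans (cong (F x ℚ.+ G x ℚ.+_) (sumℚ-map-+ F G xs))
                                (ℚ-interchange (F x) (G x) (sumℚ (map F xs)) (sumℚ (map G xs)))

sumℚ-map-*ˡ : ∀ {A : Set} c (F : A → ℚ) xs → sumℚ (map (λ x → c ℚ.* F x) xs) ≡ c ℚ.* sumℚ (map F xs)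
sumℚ-map-*ˡ c F []       = sym (ℚP.*-zeroʳ c)
sumℚ-map-*ˡ c F (x ∷ xs) = trans (cong (c ℚ.* F x ℚ.+_) (sumℚ-map-*ˡ c F xs))
                                 (sym (ℚP.*-distribˡ-+ c (F x) (sumℚ (map F xs))))

sumℚ-map-indicator : ∀ {A : Set} (p : A → Bool) xs →
                     sumℚ (map (indicator ∘ p) xs) ≡ + length (filterᵇ p xs) / 1
sumℚ-map-indicator p []       = refl
sumℚ-map-indicator p (x ∷ xs) with p x
... | true  = trans (cong (1ℚ ℚ.+_) (sumℚ-map-indicator p xs)) (sym (/1-suc (length (filterᵇ p xs))))
... | false = trans (ℚP.+-identityˡ _) (sumℚ-map-indicator p xs)

inv-antitone : ∀ {m n} → 0 ℕ.< m → m ℕ.≤ n → inv n ℚ.≤ inv m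
inv-antitone {suc m} {suc n} _ m≤n = ℚP.toℚᵘ-cancel-≤ (begin
  toℚᵘ (inv (suc n))  ≃⟨ toℚᵘ-/ 1 n ⟩
  mkℚᵘ 1ℤ n           ≤⟨ *≤* (ℤP.*-monoˡ-≤-nonNeg 1ℤ (+≤+ m≤n)) ⟩
  mkℚᵘ 1ℤ m           ≃⟨ toℚᵘ-/ 1 m ⟨
  toℚᵘ (inv (suc m))  ∎)
  where open ℚᵘP.≤-Reasoning

inv≤½s/a+½s/b : ∀ {a b d} s → 0 ℕ.< a → 0 ℕ.< b → 0 ℕ.< d →
  + 4 * (+ a * + b) ≤ (+ a + + b) * (+ d * (+ s + + s)) →
  inv d ℚ.≤ ½ ℚ.* inv a ℚ.* (+ s / 1) ℚ.+ ½ ℚ.* inv b ℚ.* (+ s / 1)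
inv≤½s/a+½s/b {suc a} {suc b} {suc d} s _ _ _ cross = ℚP.toℚᵘ-cancel-≤ (begin
  toℚᵘ (inv (suc d))  ≃⟨ toℚᵘ-/ 1 d ⟩
  mkℚᵘ 1ℤ d           ≤⟨ *≤* (ℤP.≤-trans (ℤP.≤-reflexive (denominator A B))
                                         (ℤP.≤-trans cross (ℤP.≤-reflexive (numerator A B D S)))) ⟩
  q                   ≃⟨ ℚᵘP.+-cong (term a) (term b) ⟨
  toℚᵘ (½ ℚ.* inv (suc a) ℚ.* (+ s / 1)) ℚᵘ.+ toℚᵘ (½ ℚ.* inv (suc b) ℚ.* (+ s / 1))
                      ≃⟨ ℚP.toℚᵘ-homo-+ (½ ℚ.* inv (suc a) ℚ.* (+ s / 1)) (½ ℚ.* inv (suc b) ℚ.* (+ s / 1)) ⟨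
  toℚᵘ (½ ℚ.* inv (suc a) ℚ.* (+ s / 1) ℚ.+ ½ ℚ.* inv (suc b) ℚ.* (+ s / 1)) ∎)
  where
  open ℚᵘP.≤-Reasoning
  A B D S : ℤ
  A = + suc a
  B = + suc b
  D = + suc d
  S = + s
  q : ℚᵘ
  q = mkℚᵘ 1ℤ 1 ℚᵘ.* mkℚᵘ 1ℤ a ℚᵘ.* mkℚᵘ S 0 ℚᵘ.+ mkℚᵘ 1ℤ 1 ℚᵘ.* mkℚᵘ 1ℤ b ℚᵘ.* mkℚᵘ S 0
  term : ∀ k → toℚᵘ (½ ℚ.* inv (suc k) ℚ.* (+ s / 1)) ℚᵘ.≃ mkℚᵘ 1ℤ 1 ℚᵘ.* mkℚᵘ 1ℤ k ℚᵘ.* mkℚᵘ S 0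
  term k = ℚᵘP.≃-trans (ℚP.toℚᵘ-homo-* (½ ℚ.* inv (suc k)) (+ s / 1))
    (ℚᵘP.*-cong (ℚᵘP.≃-trans (ℚP.toℚᵘ-homo-* ½ (inv (suc k))) (ℚᵘP.*-cong (toℚᵘ-/ 1 1) (toℚᵘ-/ 1 k)))
                (toℚᵘ-/ s 0))
  denominator : ∀ A B → 1ℤ * (+ 2 * A * 1ℤ * (+ 2 * B * 1ℤ)) ≡ + 4 * (A * B)
  denominator = solve-∀
  numerator : ∀ A B D S →
    (A + B) * (D * (S + S)) ≡ (1ℤ * 1ℤ * S * (+ 2 * B * 1ℤ) + 1ℤ * 1ℤ * S * (+ 2 * A * 1ℤ)) * D
  numerator = solve-∀

-- The balanced influence

boundary₁ : ∀ {n} → (Vec Bool n → Bool) → Fin n → Vec Bool n → Bool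
boundary₁ f i x = f x ∧ not (f (flipBit i x))

module Boundary {n} (f : Vec Bool n → Bool) (i : Fin n) where

  s : ℕ
  s = count (boundary₁ f i)

  xor-as-boundary : ∀ x → ⟦ f x xor f (flipBit i x) ⟧ ≡ ⟦ boundary₁ f i x ⟧ + ⟦ boundary₁ f i (flipBit i x) ⟧
  xor-as-boundary x rewrite flipBit-involutive i x with f x | f (flipBit i x)
  ... | true  | true  = refl
  ... | true  | false = refl
  ... | false | true  = refl
  ... | false | false = refl

  influence-as-boundary : influence f i ≡ + s + + s
  influence-as-boundary = begin
    influence f i
      ≡⟨ ∑-cong xor-as-boundary ⟩
    ∑ (λ x → ⟦ boundary₁ f i x ⟧ + ⟦ boundary₁ f i (flipBit i x) ⟧)
      ≡⟨ ∑-distrib-+ {n} _ _ ⟩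
    ∑ (⟦_⟧ ∘ boundary₁ f i) + ∑ ((⟦_⟧ ∘ boundary₁ f i) ∘ flipBit i)
      ≡⟨ cong (_+_ (∑ (⟦_⟧ ∘ boundary₁ f i))) (∑-flip i (⟦_⟧ ∘ boundary₁ f i)) ⟩
    ∑ (⟦_⟧ ∘ boundary₁ f i) + ∑ (⟦_⟧ ∘ boundary₁ f i)
      ≡⟨ cong₂ _+_ (count-∑ (boundary₁ f i)) (count-∑ (boundary₁ f i)) ⟨
    + s + + s ∎
    where open ≡-Reasoning

  count-boundary₀ : count (boundary₁ f i ∘ flipBit i) ≡ s
  count-boundary₀ = ℤP.+-injective (begin
    + count (boundary₁ f i ∘ flipBit i)   ≡⟨ count-∑ (boundary₁ f i ∘ flipBit i) ⟩
    ∑ ((⟦_⟧ ∘ boundary₁ f i) ∘ flipBit i) ≡⟨ ∑-flip i (⟦_⟧ ∘ boundary₁ f i) ⟩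
    ∑ (⟦_⟧ ∘ boundary₁ f i)               ≡⟨ count-∑ (boundary₁ f i) ⟨
    + s                                   ∎)
    where open ≡-Reasoning

  weight₁ weight₀ : ℚ
  weight₁ = ½ ℚ.* inv (preimageSize f true)
  weight₀ = ½ ℚ.* inv (preimageSize f false)

  balWeight-as-boundary : ∀ x →
    balWeight f x ℚ.* indicator (f x xor f (flipBit i x)) ≡
    weight₁ ℚ.* indicator (boundary₁ f i x) ℚ.+ weight₀ ℚ.* indicator (boundary₁ f i (flipBit i x))
  balWeight-as-boundary x rewrite flipBit-involutive i x with f x | f (flipBit i x)
  ... | true  | true  = sym (trans (cong (weight₁ ℚ.* 0ℚ ℚ.+_) (ℚP.*-zeroʳ weight₀)) (ℚP.+-identityʳ _))
  ... | true  | false = sym (trans (cong (weight₁ ℚ.* 1ℚ ℚ.+_) (ℚP.*-zeroʳ weight₀)) (ℚP.+-identityʳ _))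
  ... | false | true  = sym (trans (cong (ℚ._+ weight₀ ℚ.* 1ℚ) (ℚP.*-zeroʳ weight₁)) (ℚP.+-identityˡ _))
  ... | false | false = sym (trans (cong (ℚ._+ weight₀ ℚ.* 0ℚ) (ℚP.*-zeroʳ weight₁)) (ℚP.+-identityˡ _))

  BalInf-as-boundary : BalInf i f ≡ weight₁ ℚ.* (+ s / 1) ℚ.+ weight₀ ℚ.* (+ s / 1)
  BalInf-as-boundary = begin
    BalInf i f
      ≡⟨ cong sumℚ (map-cong balWeight-as-boundary xs) ⟩
    sumℚ (map (λ x → weight₁ ℚ.* indicator (boundary₁ f i x) ℚ.+
                     weight₀ ℚ.* indicator (boundary₁ f i (flipBit i x))) xs)
      ≡⟨ sumℚ-map-+ _ _ xs ⟩
    sumℚ (map (λ x → weight₁ ℚ.* indicator (boundary₁ f i x)) xs) ℚ.+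
    sumℚ (map (λ x → weight₀ ℚ.* indicator (boundary₁ f i (flipBit i x))) xs)
      ≡⟨ cong₂ ℚ._+_ (sumℚ-map-*ˡ weight₁ _ xs) (sumℚ-map-*ˡ weight₀ _ xs) ⟩
    weight₁ ℚ.* sumℚ (map (indicator ∘ boundary₁ f i) xs) ℚ.+
    weight₀ ℚ.* sumℚ (map (indicator ∘ boundary₁ f i ∘ flipBit i) xs)
      ≡⟨ cong₂ (λ u v → weight₁ ℚ.* u ℚ.+ weight₀ ℚ.* v)
               (sumℚ-map-indicator _ xs)
               (trans (sumℚ-map-indicator _ xs) (cong (λ k → + k / 1) count-boundary₀)) ⟩
    weight₁ ℚ.* (+ s / 1) ℚ.+ weight₀ ℚ.* (+ s / 1) ∎
    where
    open ≡-Reasoning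
    xs : List (Vec Bool n)
    xs = allInputs n

osss-preimages : ∀ {n} {f : Vec Bool n → Bool} {T : DTree n} i → Computes T f →
  (∀ j → influence f j ≤ influence f i) →
  + 4 * (+ preimageSize f true * + preimageSize f false) ≤
  (+ preimageSize f true + + preimageSize f false) *
  (+ depthDT T * (+ count (boundary₁ f i) + + count (boundary₁ f i)))
osss-preimages {n} {f} {T} i T-computes-f i-maximal = begin
  + 4 * (+ preimageSize f true * + preimageSize f false)
    ≡⟨ cong (+ 4 *_) (trans sizes-* (sym (covariance-self f))) ⟩
  + 4 * covariance f f
    ≤⟨ osss-depth {T = T} i T-computes-f i-maximal ⟩
  cubeSize n * (+ depthDT T * influence f i)
    ≡⟨ cong₂ (λ N I → N * (+ depthDT T * I)) (trans (cubeSize-split f) (sym sizes-+))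
                                             (Boundary.influence-as-boundary f i) ⟩
  (+ preimageSize f true + + preimageSize f false) *
  (+ depthDT T * (+ count (boundary₁ f i) + + count (boundary₁ f i))) ∎
  where
  open ℤP.≤-Reasoning
  sizes-* : + preimageSize f true * + preimageSize f false ≡ ∑ (⟦_⟧ ∘ f) * ∑ (⟦_⟧ ∘ not ∘ f)
  sizes-* = cong₂ _*_ (preimageSize-true f) (preimageSize-false f)
  sizes-+ : + preimageSize f true + + preimageSize f false ≡ ∑ (⟦_⟧ ∘ f) + ∑ (⟦_⟧ ∘ not ∘ f)
  sizes-+ = cong₂ _+_ (preimageSize-true f) (preimageSize-false f)

nonConstant⇒0<depthDT : ∀ {n} {f : Vec Bool n → Bool} {T} → NonConstant f → Computes T f → 0 ℕ.< depthDT T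
nonConstant⇒0<depthDT {T = leaf b} (x , y , fx≢fy) T-computes-f =
  ⊥-elim (fx≢fy (trans (sym (T-computes-f x)) (T-computes-f y)))
nonConstant⇒0<depthDT {T = node _ _ _} _ _ = s≤s z≤n

shiftDT : ∀ {m} → DTree m → DTree (suc m)
shiftDT (leaf b)       = leaf b
shiftDT (node j t₀ t₁) = node (suc j) (shiftDT t₀) (shiftDT t₁)

evalDT-shiftDT : ∀ {m} (T : DTree m) b x → evalDT (shiftDT T) (b ∷ x) ≡ evalDT T x
evalDT-shiftDT (leaf _)       b x = refl
evalDT-shiftDT (node j t₀ t₁) b x with lookup x j
... | false = evalDT-shiftDT t₀ b x
... | true  = evalDT-shiftDT t₁ b x

depthDT-shiftDT : ∀ {m} (T : DTree m) → depthDT (shiftDT T) ≡ depthDT T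
depthDT-shiftDT (leaf _)       = refl
depthDT-shiftDT (node j t₀ t₁) = cong suc (cong₂ _⊔_ (depthDT-shiftDT t₀) (depthDT-shiftDT t₁))

completeTree : ∀ {n} → (Vec Bool n → Bool) → DTree n
completeTree {zero}  f = leaf (f [])
completeTree {suc n} f =
  node zero (shiftDT (completeTree (f ∘ (false ∷_)))) (shiftDT (completeTree (f ∘ (true ∷_))))

completeTree-computes : ∀ {n} (f : Vec Bool n → Bool) → Computes (completeTree f) f
completeTree-computes {zero}  f []          = refl
completeTree-computes {suc n} f (false ∷ x) =
  trans (evalDT-shiftDT (completeTree (f ∘ (false ∷_))) false x) (completeTree-computes (f ∘ (false ∷_)) x)
completeTree-computes {suc n} f (true ∷ x)  =
  trans (evalDT-shiftDT (completeTree (f ∘ (true ∷_))) true x) (completeTree-computes (f ∘ (true ∷_)) x)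

depthDT-completeTree : ∀ {n} (f : Vec Bool n → Bool) → depthDT (completeTree f) ≡ n
depthDT-completeTree {zero}  f = refl
depthDT-completeTree {suc n} f = cong suc (begin
  depthDT (shiftDT (completeTree f₀)) ⊔ depthDT (shiftDT (completeTree f₁))
    ≡⟨ cong₂ _⊔_ (depthDT-shiftDT (completeTree f₀)) (depthDT-shiftDT (completeTree f₁)) ⟩
  depthDT (completeTree f₀) ⊔ depthDT (completeTree f₁)
    ≡⟨ cong₂ _⊔_ (depthDT-completeTree f₀) (depthDT-completeTree f₁) ⟩
  n ⊔ n
    ≡⟨ ℕP.⊔-idem n ⟩
  n ∎)
  where
  open ≡-Reasoning
  f₀ f₁ : Vec Bool n → Bool
  f₀ = f ∘ (false ∷_)
  f₁ = f ∘ (true ∷_)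

depth-≤-arity : ∀ {n} {f : Vec Bool n → Bool} {d} → IsDepth f d → d ℕ.≤ n
depth-≤-arity {f = f} (_ , minimal) =
  ℕP.≤-trans (minimal (completeTree f) (completeTree-computes f)) (ℕP.≤-reflexive (depthDT-completeTree f))

maximiser : ∀ {m} (F : Fin (suc m) → ℤ) → ∃[ i ] (∀ j → F j ≤ F i)
maximiser F =
  argmax F zero (allFin _) , λ j → All.lookup (f[xs]≤f[argmax] {f = F} zero (allFin _)) (∈-allFin j)

corollary6p4 : (n : ℕ) (f : BoolFun n) → NonConstant f →
    (d : ℕ) → IsDepth f d →
    ∃[ i ] ((inv d ℚ.≤ BalInf i f) × (inv n ℚ.≤ inv d))
corollary6p4 zero    f ([] , [] , f[]≢f[]) d _ = ⊥-elim (f[]≢f[] refl)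
corollary6p4 (suc m) f nonConstant d isDepth@((T , T-computes-f , refl) , _) =
  i , balanced-bound , inv-antitone 0<depth (depth-≤-arity isDepth)
  where
  i : Fin (suc m)
  i = proj₁ (maximiser (influence f))
  0<depth : 0 ℕ.< depthDT T
  0<depth = nonConstant⇒0<depthDT nonConstant T-computes-f
  balanced-bound : inv (depthDT T) ℚ.≤ BalInf i f
  balanced-bound = subst (inv (depthDT T) ℚ.≤_) (sym (Boundary.BalInf-as-boundary f i))
    (inv≤½s/a+½s/b (count (boundary₁ f i))
      (proj₁ (preimages-nonempty nonConstant)) (proj₂ (preimages-nonempty nonConstant)) 0<depth
      (osss-preimages {T = T} i T-computes-f (proj₂ (maximiser (influence f)))))
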